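{- Let $1 \leq t \leq r$, let $m\geq1$ be an integer, and let $\mathcal{F}$ be a $(\leq r)$-family. Then $l(\mathcal{S}_{\mathcal{F},m},t) \geq m \cdot l(\mathcal{S}_{\mathcal{F},m},t+1)$.
   Context: All sets and families are finite. For an $r$-element set $X=\{x_1,\dots,x_r\}$ and integer $m\geq1$, $\mathcal{S}_{X,m}=\{\{(x_1,y_1),\dots,(x_r,y_r)\}: y_1,\dots,y_r\in[m]\}$, with $\mathcal{S}_{\emptyset,m}=\emptyset$; $\mathcal{S}_{\mathcal{F},m}=\bigcup_{F\in\mathcal{F}}\mathcal{S}_{F,m}$. A $(\leq r)$-family is one whose sets each have at most $r$ elements. $\mathcal{G}(T)=\{G\in\mathcal{G}:T\subseteq G\}$ and $l(\mathcal{G},q)=\max_{|T|=q}|\mathcal{G}(T)|$. -}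

module Defs where

open import Data.Nat using (ℕ; zero; suc; _⊔_; _≟_; _+_)
open import Data.Bool using (Bool; true; false)
open import Data.Fin using (Fin)
open import Data.Fin.Subset using (Subset; ∣_∣; ⊥; ⁅_⁆; _⊆_)
open import Data.Fin.Subset.Properties using (_⊆?_)
open import Data.List using (List; []; _∷_; [_]; map; concatMap; filter; length; foldr; allFin)
open import Data.Vec as Vec using (Vec; []; _∷_)
open import Data.Vec.Relation.Binary.Pointwise.Inductive as PW using (Pointwise)

-- Ground set of the family 𝓕 is Fin n (every finite family lives in a finite ground set).
-- A set of pairs T ⊆ Fin n × Fin m is encoded as a vector of n subsets of Fin m:
-- row x of T is { y | (x , y) ∈ T }.
PSet : ℕ → ℕ → Set
PSet n m = Vec (Subset m) n

size : ∀ {n m} → PSet n m → ℕ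
size T = Vec.foldr _ (λ s acc → ∣ s ∣ + acc) 0 T

_⊆ᵖ_ : ∀ {n m} → PSet n m → PSet n m → Set
T ⊆ᵖ G = Pointwise _⊆_ T G

allSubsets : ∀ k → List (Subset k)
allSubsets zero = [ [] ]
allSubsets (suc k) = concatMap (λ s → (false ∷ s) ∷ (true ∷ s) ∷ []) (allSubsets k)

allPSets : ∀ n m → List (PSet n m)
allPSets zero m = [ [] ]
allPSets (suc n) m =
  concatMap (λ s → map (s ∷_) (allPSets n m)) (allSubsets m)

-- all sets {(x , y_x) : x ∈ X} with y_x ∈ [m] (no emptiness special case)
labellings : ∀ {n} (m : ℕ) → Subset n → List (PSet n m)
labellings m [] = [ [] ]
labellings m (false ∷ X) = map (⊥ ∷_) (labellings m X)
labellings m (true ∷ X) =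
  concatMap (λ y → map (⁅ y ⁆ ∷_) (labellings m X)) (allFin m)

-- 𝒮_{X,m}, with the convention 𝒮_{∅,m} = ∅
𝒮 : ∀ {n} (m : ℕ) → Subset n → List (PSet n m)
𝒮 m X with ∣ X ∣
... | zero = []
... | suc _ = labellings m X

-- 𝒮_{𝓕,m} = ⋃_{F ∈ 𝓕} 𝒮_{F,m}  (the union is disjoint: F is recovered from any member)
𝒮𝓕 : ∀ {n} (m : ℕ) → List (Subset n) → List (PSet n m)
𝒮𝓕 m 𝓕 = concatMap (𝒮 m) 𝓕

count : ∀ {n m} → List (PSet n m) → PSet n m → ℕ
count 𝒢 T = length (filter (λ G → PW.decidable _⊆?_ T G) 𝒢)

-- l(𝒢,q) = max_{|T| = q} |𝒢(T)|  (max over the empty range is 0)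
l : ∀ {n m} → List (PSet n m) → ℕ → ℕ
l {n} {m} 𝒢 q = foldr _⊔_ 0 (map (count 𝒢) (filter (λ T → size T ≟ q) (allPSets n m)))

-- A member G of 𝒮_{𝓕,m} is the graph of a map F → [m]. If T' is obtained from T by deleting a
-- pair (x , y) and G ⊇ T, then relabelling x in G in any of the m possible ways yields a member of
-- 𝒮_{𝓕,m} containing T', so |𝒢(T')| ≥ m |𝒢(T)|. Applying this to a T of size t + 1 attaining
-- l(𝒢, t + 1) gives the inequality.
module Submission where

open import Defs
open import Data.Nat using (ℕ; zero; suc; _*_; _+_; _≤_; _⊔_; _≟_; z≤n; s≤s)
open import Data.Nat.Properties
open import Data.Bool using (true; false)
open import Data.Fin using (Fin)
open import Data.Fin.Subset using (Subset; ∣_∣; ⁅_⁆; _⊆_; _⊂_; _∈_; Empty)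
import Data.Fin.Subset as Subset
open import Data.Fin.Subset.Properties using (_⊆?_; x∈⁅y⁆⇒x≡y; ∉⊥; ⊆-refl; out⊂; out⊂in)
open import Data.List using (List; []; _∷_; map; concatMap; filter; length; foldr; allFin; _++_)
open import Data.List.Properties using (filter-++; length-++; filter-all; filter-none; length-tabulate; foldr-forcesᵇ)
open import Data.List.Relation.Unary.All as All using (All)
open import Data.List.Relation.Unary.All.Properties using (¬Any⇒All¬)
open import Data.List.Relation.Unary.Any as Any using (here; there; any?)
open import Data.List.Relation.Unary.AllPairs using ([]; _∷_)
open import Data.List.Relation.Unary.Unique.Propositional using (Unique)
open import Data.List.Relation.Unary.Unique.Propositional.Properties using (allFin⁺)
open import Data.List.Membership.Propositional using () renaming (_∈_ to _∈ₗ_)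
open import Data.List.Membership.Propositional.Properties
  using (∈-map⁺; ∈-map⁻; ∈-filter⁺; ∈-filter⁻; ∈-concatMap⁺; foldr-selective)
open import Data.Vec using ([]; _∷_)
import Data.Vec.Relation.Binary.Pointwise.Inductive as Pointwise
open import Data.Product using (∃-syntax; _×_; _,_; proj₁; proj₂)
open import Data.Sum using (_⊎_; inj₁; inj₂)
open import Data.Empty using (⊥-elim)
open import Relation.Nullary using (¬_; yes; no)
open import Relation.Unary using (Pred; Decidable)
open import Relation.Binary.PropositionalEquality
open import Level using (0ℓ)

private
  variable
    n m k : ℕ

count-++ : (𝒢 ℋ : List (PSet n m)) (T : PSet n m) → count (𝒢 ++ ℋ) T ≡ count 𝒢 T + count ℋ T
count-++ 𝒢 ℋ T = begin
  length (filter ⊇T? (𝒢 ++ ℋ))               ≡⟨ cong length (filter-++ ⊇T? 𝒢 ℋ) ⟩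
  length (filter ⊇T? 𝒢 ++ filter ⊇T? ℋ)      ≡⟨ length-++ (filter ⊇T? 𝒢) ⟩
  length (filter ⊇T? 𝒢) + length (filter ⊇T? ℋ) ∎
  where
    open ≡-Reasoning
    ⊇T? = λ G → Pointwise.decidable _⊆?_ T G

count-map-∷-⊆ : (a s : Subset m) (ℒ : List (PSet n m)) (T : PSet n m) → s ⊆ a →
                count (map (a ∷_) ℒ) (s ∷ T) ≡ count ℒ T
count-map-∷-⊆ a s [] T s⊆a = refl
count-map-∷-⊆ a s (G ∷ ℒ) T s⊆a with s ⊆? a | Pointwise.decidable _⊆?_ T G
... | yes _   | yes _ = cong suc (count-map-∷-⊆ a s ℒ T s⊆a)
... | yes _   | no _  = count-map-∷-⊆ a s ℒ T s⊆a
... | no s⊈a  | _     = ⊥-elim (s⊈a s⊆a)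

count-map-∷-⊈ : (a s : Subset m) (ℒ : List (PSet n m)) (T : PSet n m) → ¬ s ⊆ a →
                count (map (a ∷_) ℒ) (s ∷ T) ≡ 0
count-map-∷-⊈ a s [] T s⊈a = refl
count-map-∷-⊈ a s (G ∷ ℒ) T s⊈a with s ⊆? a
... | yes s⊆a = ⊥-elim (s⊈a s⊆a)
... | no _    = count-map-∷-⊈ a s ℒ T s⊈a

singletonsAbove : List (Fin m) → Subset m → ℕ
singletonsAbove ys s = length (filter (λ y → s ⊆? ⁅ y ⁆) ys)

count-concatMap-singletons : (ys : List (Fin m)) (ℒ : List (PSet n m)) (s : Subset m) (T : PSet n m) →
  count (concatMap (λ y → map (⁅ y ⁆ ∷_) ℒ) ys) (s ∷ T) ≡ singletonsAbove ys s * count ℒ T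
count-concatMap-singletons [] ℒ s T = refl
count-concatMap-singletons (y ∷ ys) ℒ s T
  rewrite count-++ (map (⁅ y ⁆ ∷_) ℒ) (concatMap (λ y → map (⁅ y ⁆ ∷_) ℒ) ys) (s ∷ T)
  with s ⊆? ⁅ y ⁆
... | yes s⊆y = cong₂ _+_ (count-map-∷-⊆ _ s ℒ T s⊆y) (count-concatMap-singletons ys ℒ s T)
... | no s⊈y  = cong₂ _+_ (count-map-∷-⊈ _ s ℒ T s⊈y) (count-concatMap-singletons ys ℒ s T)

length-filter≤1 : ∀ {A : Set} {P : Pred A 0ℓ} (P? : Decidable P) {i : A} → (∀ {y} → P y → y ≡ i) →
                  ∀ {xs} → Unique xs → length (filter P? xs) ≤ 1
length-filter≤1 P? only-i {[]} [] = z≤n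
length-filter≤1 {P = P} P? only-i {x ∷ xs} (x∉xs ∷ xs-unique) with P? x
... | no _   = length-filter≤1 P? only-i xs-unique
... | yes Px = s≤s (≤-reflexive (cong length (filter-none P? (All.map ¬P x∉xs))))
  where
    ¬P : ∀ {z} → x ≢ z → ¬ P z
    ¬P x≢z Pz = x≢z (trans (only-i Px) (sym (only-i Pz)))

singletonsAbove-Nonempty : ∀ {s : Subset m} {i} → i ∈ s → singletonsAbove (allFin m) s ≤ 1
singletonsAbove-Nonempty {m} {s} i∈s =
  length-filter≤1 (λ y → s ⊆? ⁅ y ⁆) (λ {y} s⊆y → sym (x∈⁅y⁆⇒x≡y y (s⊆y i∈s))) (allFin⁺ m)

singletonsAbove-Empty : ∀ {s : Subset m} → Empty s → singletonsAbove (allFin m) s ≡ m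
singletonsAbove-Empty {m} {s} s-empty = begin
  length (filter (λ y → s ⊆? ⁅ y ⁆) (allFin m)) ≡⟨ cong length (filter-all (λ y → s ⊆? ⁅ y ⁆) {xs = allFin m} (All.tabulate λ _ → s⊆)) ⟩
  length (allFin m)                              ≡⟨ length-tabulate (λ y → y) ⟩
  m                                              ∎
  where
    open ≡-Reasoning
    s⊆ : ∀ {t} → s ⊆ t
    s⊆ {x = x} x∈s = ⊥-elim (s-empty (x , x∈s))

-- A nonempty row lies in at most one singleton, and in one only if it is that singleton; a
-- strict subset of a singleton is empty and lies in all m of them.
singletonsAbove-⊂ : {s' s : Subset m} → s' ⊂ s →
                    m * singletonsAbove (allFin m) s ≤ singletonsAbove (allFin m) s'
singletonsAbove-⊂ {m} {s'} {s} (s'⊆s , i , i∈s , i∉s') with any? (λ y → s ⊆? ⁅ y ⁆) (allFin m)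
... | no none rewrite filter-none (λ y → s ⊆? ⁅ y ⁆) (¬Any⇒All¬ (allFin m) none) | *-zeroʳ m = z≤n
... | yes some = begin
    m * singletonsAbove (allFin m) s ≤⟨ *-monoʳ-≤ m (singletonsAbove-Nonempty i∈s) ⟩
    m * 1                            ≡⟨ *-identityʳ m ⟩
    m                                ≡⟨ singletonsAbove-Empty s'-empty ⟨
    singletonsAbove (allFin m) s'    ∎
  where
    open ≤-Reasoning
    y = proj₁ (Any.satisfied some)
    ≡y : ∀ {x} → x ∈ s → x ≡ y
    ≡y x∈s = x∈⁅y⁆⇒x≡y y (proj₂ (Any.satisfied some) x∈s)
    s'-empty : Empty s'
    s'-empty (x , x∈s') = i∉s' (subst (_∈ s') (trans (≡y (s'⊆s x∈s')) (sym (≡y i∈s))) x∈s')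

data ShrinksOneRow : PSet n m → PSet n m → Set where
  here  : ∀ {s' s} {T : PSet n m} → s' ⊂ s → ShrinksOneRow (s' ∷ T) (s ∷ T)
  there : ∀ {a} {T' T : PSet n m} → ShrinksOneRow T' T → ShrinksOneRow (a ∷ T') (a ∷ T)

labellings-count-shrink : (F : Subset n) {T' T : PSet n m} → ShrinksOneRow T' T →
                          m * count (labellings m F) T ≤ count (labellings m F) T'
labellings-count-shrink {m = m} (false ∷ F) {_} {s ∷ T} (here (_ , _ , i∈s , _))
  rewrite count-map-∷-⊈ _ s (labellings m F) T (λ s⊆⊥ → ∉⊥ (s⊆⊥ i∈s)) | *-zeroʳ m = z≤n
labellings-count-shrink {m = m} (true ∷ F) {s' ∷ T} {s ∷ T} (here s'⊂s)
  rewrite count-concatMap-singletons (allFin m) (labellings m F) s T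
        | count-concatMap-singletons (allFin m) (labellings m F) s' T
        | sym (*-assoc m (singletonsAbove (allFin m) s) (count (labellings m F) T))
  = *-monoˡ-≤ (count (labellings m F) T) (singletonsAbove-⊂ s'⊂s)
labellings-count-shrink {m = m} (false ∷ F) {a ∷ T'} {a ∷ T} (there shrinks) with a ⊆? Subset.⊥
... | yes a⊆⊥ rewrite count-map-∷-⊆ _ a (labellings m F) T a⊆⊥ | count-map-∷-⊆ _ a (labellings m F) T' a⊆⊥
  = labellings-count-shrink F shrinks
... | no a⊈⊥ rewrite count-map-∷-⊈ _ a (labellings m F) T a⊈⊥ | count-map-∷-⊈ _ a (labellings m F) T' a⊈⊥
                   | *-zeroʳ m = z≤n
labellings-count-shrink {m = m} (true ∷ F) {a ∷ T'} {a ∷ T} (there shrinks)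
  rewrite count-concatMap-singletons (allFin m) (labellings m F) a T
        | count-concatMap-singletons (allFin m) (labellings m F) a T'
        | sym (*-assoc m (singletonsAbove (allFin m) a) (count (labellings m F) T))
        | *-comm m (singletonsAbove (allFin m) a)
        | *-assoc (singletonsAbove (allFin m) a) m (count (labellings m F) T)
  = *-monoʳ-≤ (singletonsAbove (allFin m) a) (labellings-count-shrink F shrinks)

𝒮-count-shrink : (F : Subset n) {T' T : PSet n m} → ShrinksOneRow T' T →
                 m * count (𝒮 m F) T ≤ count (𝒮 m F) T'
𝒮-count-shrink {m = m} F shrinks with ∣ F ∣
... | zero  rewrite *-zeroʳ m = z≤n
... | suc _ = labellings-count-shrink F shrinks

𝒮𝓕-count-shrink : (𝓕 : List (Subset n)) {T' T : PSet n m} → ShrinksOneRow T' T →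
                  m * count (𝒮𝓕 m 𝓕) T ≤ count (𝒮𝓕 m 𝓕) T'
𝒮𝓕-count-shrink {m = m} [] shrinks rewrite *-zeroʳ m = z≤n
𝒮𝓕-count-shrink {m = m} (F ∷ 𝓕) {T'} {T} shrinks
  rewrite count-++ (𝒮 m F) (𝒮𝓕 m 𝓕) T | count-++ (𝒮 m F) (𝒮𝓕 m 𝓕) T'
        | *-distribˡ-+ m (count (𝒮 m F) T) (count (𝒮𝓕 m 𝓕) T)
  = +-mono-≤ (𝒮-count-shrink F shrinks) (𝒮𝓕-count-shrink 𝓕 shrinks)

remove-element : (s : Subset m) → ∣ s ∣ ≡ suc k → ∃[ s' ] s' ⊂ s × ∣ s' ∣ ≡ k
remove-element (true ∷ s) ∣s∣≡ = false ∷ s , out⊂in ⊆-refl , suc-injective ∣s∣≡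
remove-element (false ∷ s) ∣s∣≡ with remove-element s ∣s∣≡
... | s' , s'⊂s , ∣s'∣≡ = false ∷ s' , out⊂ s'⊂s , ∣s'∣≡

remove-pair : (T : PSet n m) → size T ≡ suc k → ∃[ T' ] ShrinksOneRow T' T × size T' ≡ k
remove-pair (a ∷ T) size≡ with ∣ a ∣ in ∣a∣≡
... | zero with remove-pair T size≡
...   | T' , shrinks , size'≡ = a ∷ T' , there shrinks , trans (cong (_+ size T') ∣a∣≡) size'≡
remove-pair (a ∷ T) size≡ | suc _ with remove-element a ∣a∣≡
... | a' , a'⊂a , ∣a'∣≡ = a' ∷ T , here a'⊂a , trans (cong (_+ size T) ∣a'∣≡) (suc-injective size≡)

∈-allSubsets : (s : Subset k) → s ∈ₗ allSubsets k
∈-allSubsets [] = here refl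
∈-allSubsets (false ∷ s) = ∈-concatMap⁺ _ (Any.map (λ { refl → here refl }) (∈-allSubsets s))
∈-allSubsets (true ∷ s)  = ∈-concatMap⁺ _ (Any.map (λ { refl → there (here refl) }) (∈-allSubsets s))

∈-allPSets : (T : PSet n m) → T ∈ₗ allPSets n m
∈-allPSets [] = here refl
∈-allPSets (s ∷ T) = ∈-concatMap⁺ _ (Any.map (λ { refl → ∈-map⁺ (s ∷_) (∈-allPSets T) }) (∈-allSubsets s))

≤-foldr-⊔ : (xs : List ℕ) {x : ℕ} → x ∈ₗ xs → x ≤ foldr _⊔_ 0 xs
≤-foldr-⊔ xs = All.lookup (foldr-forcesᵇ (λ x y x⊔y≤ → m⊔n≤o⇒m≤o x y x⊔y≤ , m⊔n≤o⇒n≤o x y x⊔y≤) 0 xs ≤-refl)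

count≤l : (𝒢 : List (PSet n m)) (T : PSet n m) → count 𝒢 T ≤ l 𝒢 (size T)
count≤l {n} {m} 𝒢 T = ≤-foldr-⊔ _ (∈-map⁺ (count 𝒢) (∈-filter⁺ (λ T → size T ≟ _) (∈-allPSets T) refl))

l-attained : (𝒢 : List (PSet n m)) (q : ℕ) → l 𝒢 q ≡ 0 ⊎ ∃[ T ] size T ≡ q × l 𝒢 q ≡ count 𝒢 T
l-attained {n} {m} 𝒢 q with foldr-selective ⊔-sel 0 (map (count 𝒢) (filter (λ T → size T ≟ q) (allPSets n m)))
... | inj₁ l≡0 = inj₁ l≡0
... | inj₂ l∈ with ∈-map⁻ (count 𝒢) l∈
...   | T , T∈ , l≡ = inj₂ (T , proj₂ (∈-filter⁻ (λ T → size T ≟ q) {xs = allPSets n m} T∈) , l≡)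

lemma4p3 : (n r t m : ℕ) → 1 ≤ t → t ≤ r → 1 ≤ m →
           (𝓕 : List (Subset n)) → Unique 𝓕 → All (λ F → ∣ F ∣ ≤ r) 𝓕 →
           m * l (𝒮𝓕 m 𝓕) (suc t) ≤ l (𝒮𝓕 m 𝓕) t
lemma4p3 n r t m _ _ _ 𝓕 _ _ with l-attained (𝒮𝓕 m 𝓕) (suc t)
... | inj₁ l≡0 rewrite l≡0 | *-zeroʳ m = z≤n
... | inj₂ (T , size≡ , l≡) with remove-pair T size≡
...   | T' , shrinks , size'≡ = begin
  m * l (𝒮𝓕 m 𝓕) (suc t)   ≡⟨ cong (m *_) l≡ ⟩
  m * count (𝒮𝓕 m 𝓕) T     ≤⟨ 𝒮𝓕-count-shrink 𝓕 shrinks ⟩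
  count (𝒮𝓕 m 𝓕) T'        ≤⟨ count≤l (𝒮𝓕 m 𝓕) T' ⟩
  l (𝒮𝓕 m 𝓕) (size T')     ≡⟨ cong (l (𝒮𝓕 m 𝓕)) size'≡ ⟩
  l (𝒮𝓕 m 𝓕) t             ∎
  where open ≤-Reasoning
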